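{- Let $n$ be even and consider the complete bipartite graph $K_{n/2,n/2}$ with parts $L=\{1,3,\dots,n-1\}$ and $R=\{2,4,\dots,n\}$. There exists an absolute constant $\delta>0$ such that, with $\tau=n^{\delta}$ and $\mathcal{M}$ a uniformly random perfect matching between $L$ and $R$: for all $t\le\tau$, $\Pr_{\mathcal{M}}[\mathcal{M}\text{ is }t\text{ -good}]\le 1/n^{\Omega(t)}$; and for all $t>\tau$, $\Pr_{\mathcal{M}}[\mathcal{M}\text{ is }t\text{ -self good}]\le 1/n^{\Omega(t)}$.
   Context: For a matching $\mathcal{M}$ and an edge $(i,j)\in\mathcal{M}$ write $\mathcal{M}(i)=j$ and $\mathcal{M}(j)=i$. A matching $\mathcal{M}$ between $L$ and $R$ is $t$-good if for every $i\in[t]$, $\mathcal{M}(2i-1)\in\{2,4,\dots,2t\}$ or $\mathcal{M}(2i)\in\{1,3,\dots,2t-1\}$. A $t$-good matching is $t$-self good if for every subset $T\subseteq[t]$ of size $t/2$ there exists $i\in T$ with $\mathcal{M}(2i-1)=2i$. -}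

module Defs where

open import Data.Bool using (Bool; true; false; _∧_; _∨_; not; if_then_else_)
open import Data.Nat using (ℕ; zero; suc; _+_; _*_; _∸_; _≡ᵇ_; _/_; _%_)
open import Data.List using (List; []; _∷_; map; concatMap; filterᵇ; length; upTo; _++_)
open import Data.Bool.ListAction using (all; any)

-- Vertices of K_{m,m} (n = 2m) are the natural numbers 1..2m;
-- L = odd vertices {1,3,..,2m-1}, R = even vertices {2,4,..,2m}.
-- A perfect matching between L and R is encoded by a duplicate-free list
-- σ = [σ₁,…,σₘ] with entries in {1..m}: the odd vertex 2i-1 is matched
-- to the even vertex 2σᵢ.

range1 : ℕ → List ℕ
range1 k = map suc (upTo k)

elemᵇ : ℕ → List ℕ → Bool
elemᵇ x xs = any (λ y → x ≡ᵇ y) xs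

nodupᵇ : List ℕ → Bool
nodupᵇ [] = true
nodupᵇ (x ∷ xs) = not (elemᵇ x xs) ∧ nodupᵇ xs

allLists : ℕ → ℕ → List (List ℕ)
allLists zero m = [] ∷ []
allLists (suc k) m = concatMap (λ xs → map (λ x → x ∷ xs) (range1 m)) (allLists k m)

matchings : ℕ → List (List ℕ)
matchings m = filterᵇ nodupᵇ (allLists m m)

-- 0-indexed lookup with default 0
lookupD : List ℕ → ℕ → ℕ
lookupD [] _ = 0
lookupD (x ∷ xs) zero = x
lookupD (x ∷ xs) (suc i) = lookupD xs i

-- 1-based position of x in the list (0 if absent)
posOf : ℕ → List ℕ → ℕ
posOf x [] = 0
posOf x (y ∷ ys) = if x ≡ᵇ y then 1 else (if posOf x ys ≡ᵇ 0 then 0 else suc (posOf x ys))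

mate : List ℕ → ℕ → ℕ
mate σ v = if (v % 2) ≡ᵇ 0
           then 2 * posOf (v / 2) σ ∸ 1
           else 2 * lookupD σ (v / 2)

evensUpTo : ℕ → List ℕ
evensUpTo t = map (λ k → 2 * k) (range1 t)

oddsUpTo : ℕ → List ℕ
oddsUpTo t = map (λ k → 2 * k ∸ 1) (range1 t)

isGood : ℕ → List ℕ → Bool
isGood t σ = all (λ i → elemᵇ (mate σ (2 * i ∸ 1)) (evensUpTo t)
                        ∨ elemᵇ (mate σ (2 * i)) (oddsUpTo t)) (range1 t)

sublists : List ℕ → List (List ℕ)
sublists [] = [] ∷ []
sublists (x ∷ xs) = sublists xs ++ map (λ s → x ∷ s) (sublists xs)

halfSubsets : ℕ → List (List ℕ)
halfSubsets t = filterᵇ (λ T → length T ≡ᵇ t / 2) (sublists (range1 t))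

isSelfGood : ℕ → List ℕ → Bool
isSelfGood t σ = isGood t σ ∧
  all (λ T → any (λ i → mate σ (2 * i ∸ 1) ≡ᵇ 2 * i) T) (halfSubsets t)

goodCount : ℕ → ℕ → ℕ
goodCount m t = length (filterᵇ (isGood t) (matchings m))

selfGoodCount : ℕ → ℕ → ℕ
selfGoodCount m t = length (filterᵇ (isSelfGood t) (matchings m))

totalCount : ℕ → ℕ
totalCount m = length (matchings m)

-- View σ ∈ matchings m as a uniformly random injection [m] → [m] revealed one position at a time.
-- Fix u, a weight X ≥ 1 and sets S_j ⊆ [m] (j < u) with (X − 1)|S_j| ≤ m − j, and count
-- hits(σ) = #{j < u : σ_j ∈ S_j}.  When position j is revealed m − j values are still free, so
-- the factor X ^ [σ_j ∈ S_j] has conditional mean at most (m − j + (X − 1)|S_j|)/(m − j) ≤ 2;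
-- hence E[X ^ hits] ≤ 2 ^ u, and Markov gives Pr[hits ≥ h] ≤ 2 ^ u / X ^ h.
--
-- If σ is t-good, every i ≤ t has σ_i ≤ t or σ⁻¹(i) ≤ t, and the latter i are distinct values
-- σ_j ≤ t with j ≤ t; so at least t/2 of σ_1, …, σ_t lie in [t].  Take S_j = [t] and X ≈ m/t,
-- which is at least (512 m)^(1/4) when t⁴ ≤ 2m.  If σ is t-self good, fewer than t/2 of 1, …, t
-- are not fixed, so at least t/4 of the first t − ⌊t/4⌋ positions are fixed points; take
-- S_j = {j} and X ≈ m/4 ≥ (512 m)^(1/2).  In both cases 2 ^ t / X ^ h ≤ (2m)^(−t/8).

module Submission where

open import Defs
open import Data.Nat using (ℕ; _+_; _*_; _^_; _≤_; _<_)
open import Data.Product using (Σ; _×_; ∃-syntax)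
open import Data.Bool using (Bool; true; false; _∧_; _∨_; not; T; T?; if_then_else_)
open import Data.Bool.ListAction using (all; any)
open import Data.Nat using (zero; suc; pred; _∸_; _≡ᵇ_; _<ᵇ_; _≤ᵇ_; z≤n; s≤s; s≤s⁻¹; >-nonZero)
open import Data.Nat.Properties
open import Data.Nat.DivMod
open import Data.Nat.Solver using (module +-*-Solver)
open import Data.List using (List; []; _∷_; map; concat; filterᵇ; length; take; applyUpTo; _++_)
open import Data.List.Properties using (map-upTo; map-applyUpTo; length-take; length-filter)
open import Data.List.Membership.Propositional using (_∈_)
open import Data.List.Membership.Propositional.Properties using (∈-map⁺; ∈-++⁺ˡ; ∈-++⁺ʳ; ∈-filter⁺)
open import Data.List.Relation.Unary.Any using (here; there)
open import Data.List.Relation.Binary.Sublist.Propositional using (_⊆_; []; _∷_; _∷ʳ_; ⊆-trans)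
open import Data.List.Relation.Binary.Sublist.Propositional.Properties using (take-⊆; filter-⊆)
open import Data.Product using (_,_)
open import Data.Sum using (inj₁; inj₂)
open import Data.Empty using (⊥-elim)
open import Data.Bool.Properties using (∧-conicalˡ; ∧-conicalʳ; ∧-identityʳ; ∧-zeroʳ; not-injective; T-≡)
open import Function using (_∘_)
open import Function.Bundles using (Equivalence)
open import Relation.Binary.PropositionalEquality
open import Relation.Nullary using (yes; no; contradiction)

𝟙 : Bool → ℕ
𝟙 true = 1
𝟙 false = 0

𝟙≤1 : ∀ b → 𝟙 b ≤ 1
𝟙≤1 true = ≤-refl
𝟙≤1 false = z≤n

𝟙-∧ : ∀ a b → 𝟙 (a ∧ b) ≡ 𝟙 a * 𝟙 b
𝟙-∧ true b = sym (+-identityʳ (𝟙 b))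
𝟙-∧ false b = refl

≡ᵇ-refl : ∀ x → (x ≡ᵇ x) ≡ true
≡ᵇ-refl zero = refl
≡ᵇ-refl (suc x) = ≡ᵇ-refl x

≡ᵇ-sym : ∀ x y → (x ≡ᵇ y) ≡ (y ≡ᵇ x)
≡ᵇ-sym zero zero = refl
≡ᵇ-sym zero (suc y) = refl
≡ᵇ-sym (suc x) zero = refl
≡ᵇ-sym (suc x) (suc y) = ≡ᵇ-sym x y

≡ᵇ-true⇒≡ : ∀ x y → (x ≡ᵇ y) ≡ true → x ≡ y
≡ᵇ-true⇒≡ x y e = ≡ᵇ⇒≡ x y (Equivalence.from T-≡ e)

<⇒<ᵇ≡true : ∀ {i n} → i < n → (i <ᵇ n) ≡ true
<⇒<ᵇ≡true p = Equivalence.to T-≡ (<⇒<ᵇ p)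

+-interchange : ∀ a b c d → a + b + (c + d) ≡ a + c + (b + d)
+-interchange a b c d = begin
    a + b + (c + d)   ≡⟨ +-assoc a b (c + d) ⟩
    a + (b + (c + d)) ≡⟨ cong (a +_) (sym (+-assoc b c d)) ⟩
    a + (b + c + d)   ≡⟨ cong (λ z → a + (z + d)) (+-comm b c) ⟩
    a + (c + b + d)   ≡⟨ cong (a +_) (+-assoc c b d) ⟩
    a + (c + (b + d)) ≡⟨ sym (+-assoc a c (b + d)) ⟩
    a + c + (b + d)   ∎
  where open ≡-Reasoning

∸-suc-< : ∀ {j n} → j < n → n ∸ j ≡ suc (n ∸ suc j)
∸-suc-< {zero} {suc n} _ = refl
∸-suc-< {suc j} {suc n} (s≤s j<n) = ∸-suc-< j<n

sumOver : {A : Set} → (A → ℕ) → List A → ℕ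
sumOver f [] = 0
sumOver f (x ∷ xs) = f x + sumOver f xs

module _ {A : Set} where

  sumOver-++ : (f : A → ℕ) (xs ys : List A) → sumOver f (xs ++ ys) ≡ sumOver f xs + sumOver f ys
  sumOver-++ f [] ys = refl
  sumOver-++ f (x ∷ xs) ys rewrite sumOver-++ f xs ys = sym (+-assoc (f x) _ _)

  sumOver-concat : (f : A → ℕ) (xss : List (List A)) → sumOver f (concat xss) ≡ sumOver (sumOver f) xss
  sumOver-concat f [] = refl
  sumOver-concat f (xs ∷ xss) = trans (sumOver-++ f xs (concat xss)) (cong (sumOver f xs +_) (sumOver-concat f xss))

  sumOver-cong : {f g : A → ℕ} → (∀ x → f x ≡ g x) → (xs : List A) → sumOver f xs ≡ sumOver g xs
  sumOver-cong e [] = refl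
  sumOver-cong e (x ∷ xs) = cong₂ _+_ (e x) (sumOver-cong e xs)

  sumOver-mono : {f g : A → ℕ} → (∀ x → f x ≤ g x) → (xs : List A) → sumOver f xs ≤ sumOver g xs
  sumOver-mono e [] = z≤n
  sumOver-mono e (x ∷ xs) = +-mono-≤ (e x) (sumOver-mono e xs)

  sumOver-*ˡ : (c : ℕ) (f : A → ℕ) (xs : List A) → sumOver (λ x → c * f x) xs ≡ c * sumOver f xs
  sumOver-*ˡ c f [] = sym (*-zeroʳ c)
  sumOver-*ˡ c f (x ∷ xs) rewrite sumOver-*ˡ c f xs = sym (*-distribˡ-+ c (f x) (sumOver f xs))

  sumOver-filterᵇ : (p : A → Bool) (f : A → ℕ) (xs : List A) →
    sumOver f (filterᵇ p xs) ≡ sumOver (λ x → 𝟙 (p x) * f x) xs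
  sumOver-filterᵇ p f [] = refl
  sumOver-filterᵇ p f (x ∷ xs) with p x
  ... | true = cong₂ _+_ (sym (+-identityʳ (f x))) (sumOver-filterᵇ p f xs)
  ... | false = sumOver-filterᵇ p f xs

  length-filterᵇ : (p : A → Bool) (xs : List A) → length (filterᵇ p xs) ≡ sumOver (𝟙 ∘ p) xs
  length-filterᵇ p [] = refl
  length-filterᵇ p (x ∷ xs) with p x
  ... | true = cong suc (length-filterᵇ p xs)
  ... | false = length-filterᵇ p xs

sumOver-map : {A B : Set} (f : B → ℕ) (g : A → B) (xs : List A) → sumOver f (map g xs) ≡ sumOver (f ∘ g) xs
sumOver-map f g [] = refl
sumOver-map f g (x ∷ xs) = cong (f (g x) +_) (sumOver-map f g xs)

sumBelow : ℕ → (ℕ → ℕ) → ℕ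
sumBelow zero f = 0
sumBelow (suc n) f = sumBelow n f + f n

sumBelow-cong : {f g : ℕ → ℕ} (n : ℕ) → (∀ i → i < n → f i ≡ g i) → sumBelow n f ≡ sumBelow n g
sumBelow-cong zero e = refl
sumBelow-cong (suc n) e = cong₂ _+_ (sumBelow-cong n (λ i p → e i (m≤n⇒m≤1+n p))) (e n ≤-refl)

sumBelow-mono : {f g : ℕ → ℕ} (n : ℕ) → (∀ i → i < n → f i ≤ g i) → sumBelow n f ≤ sumBelow n g
sumBelow-mono zero e = z≤n
sumBelow-mono (suc n) e = +-mono-≤ (sumBelow-mono n (λ i p → e i (m≤n⇒m≤1+n p))) (e n ≤-refl)

sumBelow-const : (c n : ℕ) → sumBelow n (λ _ → c) ≡ n * c
sumBelow-const c zero = refl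
sumBelow-const c (suc n) rewrite sumBelow-const c n = +-comm (n * c) c

sumBelow-1 : (n : ℕ) → sumBelow n (λ _ → 1) ≡ n
sumBelow-1 n = trans (sumBelow-const 1 n) (*-identityʳ n)

sumBelow-suc : (f : ℕ → ℕ) (n : ℕ) → sumBelow (suc n) f ≡ f 0 + sumBelow n (f ∘ suc)
sumBelow-suc f zero = +-comm 0 (f 0)
sumBelow-suc f (suc n) rewrite sumBelow-suc f n = +-assoc (f 0) _ _

sumBelow-+ : (f g : ℕ → ℕ) (n : ℕ) → sumBelow n (λ i → f i + g i) ≡ sumBelow n f + sumBelow n g
sumBelow-+ f g zero = refl
sumBelow-+ f g (suc n) rewrite sumBelow-+ f g n = +-interchange (sumBelow n f) (sumBelow n g) (f n) (g n)

sumBelow-*ˡ : (c : ℕ) (f : ℕ → ℕ) (n : ℕ) → sumBelow n (λ i → c * f i) ≡ c * sumBelow n f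
sumBelow-*ˡ c f zero = sym (*-zeroʳ c)
sumBelow-*ˡ c f (suc n) rewrite sumBelow-*ˡ c f n = sym (*-distribˡ-+ c (sumBelow n f) (f n))

sumBelow-*ʳ : (c : ℕ) (f : ℕ → ℕ) (n : ℕ) → sumBelow n (λ i → f i * c) ≡ sumBelow n f * c
sumBelow-*ʳ c f zero = refl
sumBelow-*ʳ c f (suc n) rewrite sumBelow-*ʳ c f n = sym (*-distribʳ-+ c (sumBelow n f) (f n))

sumBelow-swap : (f : ℕ → ℕ → ℕ) (n k : ℕ) →
  sumBelow n (λ i → sumBelow k (f i)) ≡ sumBelow k (λ j → sumBelow n (λ i → f i j))
sumBelow-swap f zero k = sym (trans (sumBelow-const 0 k) (*-zeroʳ k))
sumBelow-swap f (suc n) k rewrite sumBelow-swap f n k = sym (sumBelow-+ (λ j → sumBelow n (λ i → f i j)) (f n) k)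

sumOver-sumBelow-swap : {A : Set} (f : ℕ → A → ℕ) (n : ℕ) (xs : List A) →
  sumOver (λ x → sumBelow n (λ i → f i x)) xs ≡ sumBelow n (λ i → sumOver (f i) xs)
sumOver-sumBelow-swap f n [] = sym (trans (sumBelow-const 0 n) (*-zeroʳ n))
sumOver-sumBelow-swap f n (x ∷ xs) rewrite sumOver-sumBelow-swap f n xs =
  sym (sumBelow-+ (λ i → f i x) (λ i → sumOver (f i) xs) n)

sumOver-applyUpTo : (f g : ℕ → ℕ) (n : ℕ) → sumOver f (applyUpTo g n) ≡ sumBelow n (f ∘ g)
sumOver-applyUpTo f g zero = refl
sumOver-applyUpTo f g (suc n) =
  trans (cong (f (g 0) +_) (sumOver-applyUpTo f (g ∘ suc) n)) (sym (sumBelow-suc (f ∘ g) n))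

sumOver-range1 : (f : ℕ → ℕ) (n : ℕ) → sumOver f (range1 n) ≡ sumBelow n (f ∘ suc)
sumOver-range1 f n = trans (cong (sumOver f) (map-upTo suc n)) (sumOver-applyUpTo f suc n)

sumBelow-term : (f : ℕ → ℕ) (n j : ℕ) → j < n → f j ≤ sumBelow n f
sumBelow-term f (suc n) j p with m≤n⇒m<n∨m≡n (s≤s⁻¹ p)
... | inj₁ q = ≤-trans (sumBelow-term f n j q) (m≤m+n _ _)
... | inj₂ refl = m≤n+m _ _

sumBelow-+-≤ : ∀ u d (f : ℕ → ℕ) → (∀ i → f i ≤ 1) → sumBelow (u + d) f ≤ sumBelow u f + d
sumBelow-+-≤ u zero f h rewrite +-identityʳ u | +-identityʳ (sumBelow u f) = ≤-refl
sumBelow-+-≤ u (suc d) f h rewrite +-suc u d = begin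
    sumBelow (u + d) f + f (u + d) ≤⟨ +-mono-≤ (sumBelow-+-≤ u d f h) (h (u + d)) ⟩
    sumBelow u f + d + 1           ≡⟨ +-assoc (sumBelow u f) d 1 ⟩
    sumBelow u f + (d + 1)         ≡⟨ cong (sumBelow u f +_) (+-comm d 1) ⟩
    sumBelow u f + suc d           ∎
  where open ≤-Reasoning

count-≡ᵇ : ∀ y n → sumBelow n (λ j → 𝟙 (j ≡ᵇ y)) ≡ 𝟙 (y <ᵇ n)
count-≡ᵇ y zero = refl
count-≡ᵇ y (suc n) rewrite count-≡ᵇ y n = step y n
  where
  step : ∀ y n → 𝟙 (y <ᵇ n) + 𝟙 (n ≡ᵇ y) ≡ 𝟙 (y <ᵇ suc n)
  step zero zero = refl
  step zero (suc n) = refl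
  step (suc y) zero = refl
  step (suc y) (suc n) = step y n

count-<ᵇ : ∀ m t → sumBelow m (λ i → 𝟙 (i <ᵇ t)) ≤ t
count-<ᵇ m t = begin
    sumBelow m (λ i → 𝟙 (i <ᵇ t))                   ≡⟨ sumBelow-cong m (λ i _ → sym (count-≡ᵇ i t)) ⟩
    sumBelow m (λ i → sumBelow t (λ k → 𝟙 (k ≡ᵇ i))) ≡⟨ sumBelow-swap (λ i k → 𝟙 (k ≡ᵇ i)) m t ⟩
    sumBelow t (λ k → sumBelow m (λ i → 𝟙 (k ≡ᵇ i))) ≤⟨ sumBelow-mono t (λ k _ → at-most-one k) ⟩
    sumBelow t (λ _ → 1)                             ≡⟨ sumBelow-1 t ⟩
    t                                                ∎
  where
  open ≤-Reasoning
  at-most-one : ∀ k → sumBelow m (λ i → 𝟙 (k ≡ᵇ i)) ≤ 1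
  at-most-one k = ≤-trans (≤-reflexive (trans (sumBelow-cong m (λ i _ → cong 𝟙 (≡ᵇ-sym k i))) (count-≡ᵇ k m))) (𝟙≤1 _)

fresh : List ℕ → List ℕ → Bool
fresh F xs = nodupᵇ xs ∧ all (λ y → not (elemᵇ y F)) xs

fresh-[] : ∀ xs → fresh [] xs ≡ nodupᵇ xs
fresh-[] xs = trans (cong (nodupᵇ xs ∧_) (avoids-[] xs)) (∧-identityʳ (nodupᵇ xs))
  where
  avoids-[] : ∀ xs → all (λ y → not (elemᵇ y [])) xs ≡ true
  avoids-[] [] = refl
  avoids-[] (x ∷ xs) = avoids-[] xs

avoids-∷ : ∀ x F xs →
  all (λ y → not ((y ≡ᵇ x) ∨ elemᵇ y F)) xs ≡ not (elemᵇ x xs) ∧ all (λ y → not (elemᵇ y F)) xs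
avoids-∷ x F [] = refl
avoids-∷ x F (y ∷ xs) rewrite avoids-∷ x F xs | ≡ᵇ-sym y x =
  shuffle (x ≡ᵇ y) (elemᵇ y F) (elemᵇ x xs) (all (λ y → not (elemᵇ y F)) xs)
  where
  shuffle : ∀ a b c d → not (a ∨ b) ∧ (not c ∧ d) ≡ not (a ∨ c) ∧ (not b ∧ d)
  shuffle true b c d = refl
  shuffle false true true d = refl
  shuffle false true false d = refl
  shuffle false false c d = refl

fresh-∷ : ∀ F x xs → fresh F (x ∷ xs) ≡ not (elemᵇ x F) ∧ fresh (x ∷ F) xs
fresh-∷ F x xs rewrite avoids-∷ x F xs =
  shuffle (elemᵇ x xs) (nodupᵇ xs) (elemᵇ x F) (all (λ y → not (elemᵇ y F)) xs)
  where
  shuffle : ∀ a b c d → (not a ∧ b) ∧ (not c ∧ d) ≡ not c ∧ (b ∧ (not a ∧ d))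
  shuffle true true true d = refl
  shuffle true true false d = refl
  shuffle true false true d = refl
  shuffle true false false d = refl
  shuffle false true true d = refl
  shuffle false true false d = refl
  shuffle false false true d = refl
  shuffle false false false d = refl

fallingFactorial : ℕ → ℕ → ℕ
fallingFactorial a zero = 1
fallingFactorial a (suc k) = a * fallingFactorial (pred a) k

module Injections (m : ℕ) where

  sumOver-allLists-suc : (f : List ℕ → ℕ) (k : ℕ) →
    sumOver f (allLists (suc k) m) ≡ sumBelow m (λ i → sumOver (λ xs → f (suc i ∷ xs)) (allLists k m))
  sumOver-allLists-suc f k = begin
      sumOver f (concat (map extend (allLists k m)))
        ≡⟨ sumOver-concat f (map extend (allLists k m)) ⟩
      sumOver (sumOver f) (map extend (allLists k m))
        ≡⟨ sumOver-map (sumOver f) extend (allLists k m) ⟩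
      sumOver (λ xs → sumOver f (extend xs)) (allLists k m)
        ≡⟨ sumOver-cong (λ xs → trans (sumOver-map f (_∷ xs) (range1 m)) (sumOver-range1 (λ x → f (x ∷ xs)) m)) (allLists k m) ⟩
      sumOver (λ xs → sumBelow m (λ i → f (suc i ∷ xs))) (allLists k m)
        ≡⟨ sumOver-sumBelow-swap (λ i xs → f (suc i ∷ xs)) m (allLists k m) ⟩
      sumBelow m (λ i → sumOver (λ xs → f (suc i ∷ xs)) (allLists k m)) ∎
    where
    open ≡-Reasoning
    extend : List ℕ → List (List ℕ)
    extend xs = map (_∷ xs) (range1 m)

  unused : List ℕ → ℕ
  unused F = sumBelow m (λ i → 𝟙 (not (elemᵇ (suc i) F)))

  unused-[] : unused [] ≡ m
  unused-[] = sumBelow-1 m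

  unused-∷ : ∀ F i → i < m → elemᵇ (suc i) F ≡ false → unused F ≡ suc (unused (suc i ∷ F))
  unused-∷ F i i<m i∉F = begin
      unused F
        ≡⟨ sumBelow-cong m (λ j _ → split j) ⟩
      sumBelow m (λ j → 𝟙 (not ((j ≡ᵇ i) ∨ elemᵇ (suc j) F)) + 𝟙 (j ≡ᵇ i))
        ≡⟨ sumBelow-+ _ (λ j → 𝟙 (j ≡ᵇ i)) m ⟩
      unused (suc i ∷ F) + sumBelow m (λ j → 𝟙 (j ≡ᵇ i))
        ≡⟨ cong (unused (suc i ∷ F) +_) (trans (count-≡ᵇ i m) (cong 𝟙 (<⇒<ᵇ≡true i<m))) ⟩
      unused (suc i ∷ F) + 1
        ≡⟨ +-comm _ 1 ⟩
      suc (unused (suc i ∷ F)) ∎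
    where
    open ≡-Reasoning
    split : ∀ j → 𝟙 (not (elemᵇ (suc j) F)) ≡ 𝟙 (not ((j ≡ᵇ i) ∨ elemᵇ (suc j) F)) + 𝟙 (j ≡ᵇ i)
    split j with j ≡ᵇ i in j≡i
    ... | true rewrite ≡ᵇ-true⇒≡ j i j≡i | i∉F = refl
    ... | false = sym (+-identityʳ _)

  freshCount : ℕ → List ℕ → ℕ
  freshCount k F = sumOver (𝟙 ∘ fresh F) (allLists k m)

  freshCount-suc : ∀ k F →
    freshCount (suc k) F ≡ sumBelow m (λ i → 𝟙 (not (elemᵇ (suc i) F)) * freshCount k (suc i ∷ F))
  freshCount-suc k F = trans (sumOver-allLists-suc (𝟙 ∘ fresh F) k) (sumBelow-cong m (λ i _ → term i))
    where
    term : ∀ i → sumOver (λ xs → 𝟙 (fresh F (suc i ∷ xs))) (allLists k m)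
               ≡ 𝟙 (not (elemᵇ (suc i) F)) * freshCount k (suc i ∷ F)
    term i = trans (sumOver-cong (λ xs → trans (cong 𝟙 (fresh-∷ F (suc i) xs)) (𝟙-∧ (not (elemᵇ (suc i) F)) _)) (allLists k m))
                   (sumOver-*ˡ (𝟙 (not (elemᵇ (suc i) F))) (𝟙 ∘ fresh (suc i ∷ F)) (allLists k m))

  fallingFactorial≤freshCount : ∀ k F → fallingFactorial (unused F) k ≤ freshCount k F
  fallingFactorial≤freshCount zero F = ≤-refl
  fallingFactorial≤freshCount (suc k) F = begin
      unused F * fallingFactorial (pred (unused F)) k
        ≡⟨ sym (sumBelow-*ʳ (fallingFactorial (pred (unused F)) k) _ m) ⟩
      sumBelow m (λ i → 𝟙 (not (elemᵇ (suc i) F)) * fallingFactorial (pred (unused F)) k)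
        ≤⟨ sumBelow-mono m term ⟩
      sumBelow m (λ i → 𝟙 (not (elemᵇ (suc i) F)) * freshCount k (suc i ∷ F))
        ≡⟨ sym (freshCount-suc k F) ⟩
      freshCount (suc k) F ∎
    where
    open ≤-Reasoning
    term : ∀ i → i < m → 𝟙 (not (elemᵇ (suc i) F)) * fallingFactorial (pred (unused F)) k
                        ≤ 𝟙 (not (elemᵇ (suc i) F)) * freshCount k (suc i ∷ F)
    term i i<m with elemᵇ (suc i) F in i∉F
    ... | true = z≤n
    ... | false rewrite unused-∷ F i i<m i∉F = *-monoʳ-≤ 1 (fallingFactorial≤freshCount k (suc i ∷ F))

  totalCount≡freshCount : totalCount m ≡ freshCount m []
  totalCount≡freshCount = trans (length-filterᵇ nodupᵇ (allLists m m))
    (sumOver-cong (λ σ → cong 𝟙 (sym (fresh-[] σ))) (allLists m m))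

  fallingFactorial≤totalCount : fallingFactorial m m ≤ totalCount m
  fallingFactorial≤totalCount = subst₂ (λ a b → fallingFactorial a m ≤ b)
    unused-[] (sym totalCount≡freshCount) (fallingFactorial≤freshCount m [])

module WeightedCount (m u X : ℕ) (S : ℕ → ℕ → Bool) where

  open Injections m

  hits : ℕ → List ℕ → ℕ
  hits j [] = 0
  hits j (x ∷ xs) = 𝟙 ((j <ᵇ u) ∧ S j x) + hits (suc j) xs

  -- lookupD pads σ with zeros, hence the hypothesis on S j 0.
  hits-≥ : (∀ j → S j 0 ≡ false) → ∀ σ → sumBelow u (λ i → 𝟙 (S i (lookupD σ i))) ≤ hits 0 σ
  hits-≥ S0 σ = ≤-trans (≤-reflexive (sumBelow-cong u below-u)) (from 0 σ u)
    where
    below-u : ∀ i → i < u → 𝟙 (S i (lookupD σ i)) ≡ 𝟙 ((i <ᵇ u) ∧ S i (lookupD σ i))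
    below-u i i<u = cong (λ b → 𝟙 (b ∧ S i (lookupD σ i))) (sym (<⇒<ᵇ≡true i<u))
    from : ∀ j σ n → sumBelow n (λ i → 𝟙 ((j + i <ᵇ u) ∧ S (j + i) (lookupD σ i))) ≤ hits j σ
    from j [] n = ≤-reflexive (trans (sumBelow-cong n (λ i _ → cong 𝟙 (no-hit i))) (trans (sumBelow-const 0 n) (*-zeroʳ n)))
      where
      no-hit : ∀ i → (j + i <ᵇ u) ∧ S (j + i) 0 ≡ false
      no-hit i = trans (cong ((j + i <ᵇ u) ∧_) (S0 (j + i))) (∧-zeroʳ _)
    from j (x ∷ σ) zero = z≤n
    from j (x ∷ σ) (suc n) rewrite sumBelow-suc (λ i → 𝟙 ((j + i <ᵇ u) ∧ S (j + i) (lookupD (x ∷ σ) i))) n | +-identityʳ j =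
      +-monoʳ-≤ (𝟙 ((j <ᵇ u) ∧ S j x))
        (≤-trans (≤-reflexive (sumBelow-cong n (λ i _ → cong (λ k → 𝟙 ((k <ᵇ u) ∧ S k (lookupD σ i))) (+-suc j i))))
                 (from (suc j) σ n))

  weight : ℕ → ℕ → ℕ
  weight j x = X ^ 𝟙 ((j <ᵇ u) ∧ S j x)

  weightedCount : ℕ → List ℕ → ℕ → ℕ
  weightedCount k F j = sumOver (λ xs → 𝟙 (fresh F xs) * X ^ hits j xs) (allLists k m)

  weightedCount-suc : ∀ k F j → weightedCount (suc k) F j
    ≡ sumBelow m (λ i → 𝟙 (not (elemᵇ (suc i) F)) * (weight j (suc i) * weightedCount k (suc i ∷ F) (suc j)))
  weightedCount-suc k F j =
    trans (sumOver-allLists-suc (λ xs → 𝟙 (fresh F xs) * X ^ hits j xs) k) (sumBelow-cong m (λ i _ → term i))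
    where
    regroup : ∀ a b c d → 𝟙 (a ∧ b) * (X ^ (c + d)) ≡ 𝟙 a * (X ^ c * (𝟙 b * X ^ d))
    regroup false b c d = refl
    regroup true b c d rewrite ^-distribˡ-+-* X c d | +-identityʳ (X ^ c * (𝟙 b * X ^ d)) =
      solve 3 (λ b p q → b :* (p :* q) := p :* (b :* q)) refl (𝟙 b) (X ^ c) (X ^ d)
      where open +-*-Solver
    term : ∀ i → sumOver (λ xs → 𝟙 (fresh F (suc i ∷ xs)) * X ^ hits j (suc i ∷ xs)) (allLists k m)
               ≡ 𝟙 (not (elemᵇ (suc i) F)) * (weight j (suc i) * weightedCount k (suc i ∷ F) (suc j))
    term i = begin
        sumOver (λ xs → 𝟙 (fresh F (suc i ∷ xs)) * X ^ hits j (suc i ∷ xs)) (allLists k m)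
          ≡⟨ sumOver-cong (λ xs → trans (cong (λ b → 𝟙 b * X ^ hits j (suc i ∷ xs)) (fresh-∷ F (suc i) xs))
                                        (regroup a (fresh (suc i ∷ F) xs) (𝟙 ((j <ᵇ u) ∧ S j (suc i))) (hits (suc j) xs)))
                          (allLists k m) ⟩
        sumOver (λ xs → 𝟙 a * (weight j (suc i) * (𝟙 (fresh (suc i ∷ F) xs) * X ^ hits (suc j) xs))) (allLists k m)
          ≡⟨ sumOver-*ˡ (𝟙 a) _ (allLists k m) ⟩
        𝟙 a * sumOver (λ xs → weight j (suc i) * (𝟙 (fresh (suc i ∷ F) xs) * X ^ hits (suc j) xs)) (allLists k m)
          ≡⟨ cong (𝟙 a *_) (sumOver-*ˡ (weight j (suc i)) _ (allLists k m)) ⟩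
        𝟙 a * (weight j (suc i) * weightedCount k (suc i ∷ F) (suc j)) ∎
      where
      open ≡-Reasoning
      a = not (elemᵇ (suc i) F)

  module _ (sparse : ∀ j → j < u → (X ∸ 1) * sumBelow m (λ i → 𝟙 (S j (suc i))) ≤ m ∸ j) where

    stepFactor : ℕ → ℕ
    stepFactor j = if j <ᵇ u then 2 else 1

    stepFactor-^ : ∀ j → stepFactor j * 2 ^ (u ∸ suc j) ≡ 2 ^ (u ∸ j)
    stepFactor-^ j with j <ᵇ u in j<u
    ... | true rewrite ∸-suc-< (<ᵇ⇒< j u (Equivalence.from T-≡ j<u)) = refl
    ... | false = trans (+-identityʳ _) (cong (2 ^_) (trans (m≤n⇒m∸n≡0 (m≤n⇒m≤1+n u≤j)) (sym (m≤n⇒m∸n≡0 u≤j))))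
      where
      u≤j : u ≤ j
      u≤j = ≮⇒≥ (λ p → subst T j<u (<⇒<ᵇ p))

    weightedStep≤ : ∀ F j → unused F ≡ m ∸ j →
      sumBelow m (λ i → 𝟙 (not (elemᵇ (suc i) F)) * weight j (suc i)) ≤ stepFactor j * (m ∸ j)
    weightedStep≤ F j e with j <ᵇ u in j<u
    ... | false = ≤-reflexive (trans (sumBelow-cong m (λ i _ → *-identityʳ _)) (trans e (sym (+-identityʳ _))))
    ... | true = begin
        sumBelow m (λ i → 𝟙 (not (elemᵇ (suc i) F)) * X ^ 𝟙 (S j (suc i)))
          ≤⟨ sumBelow-mono m (λ i _ → linearise (not (elemᵇ (suc i) F)) (S j (suc i))) ⟩
        sumBelow m (λ i → 𝟙 (not (elemᵇ (suc i) F)) + (X ∸ 1) * 𝟙 (S j (suc i)))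
          ≡⟨ sumBelow-+ _ _ m ⟩
        unused F + sumBelow m (λ i → (X ∸ 1) * 𝟙 (S j (suc i)))
          ≡⟨ cong₂ _+_ e (sumBelow-*ˡ (X ∸ 1) _ m) ⟩
        (m ∸ j) + (X ∸ 1) * sumBelow m (λ i → 𝟙 (S j (suc i)))
          ≤⟨ +-monoʳ-≤ (m ∸ j) (sparse j (<ᵇ⇒< j u (Equivalence.from T-≡ j<u))) ⟩
        (m ∸ j) + (m ∸ j)
          ≡⟨ cong ((m ∸ j) +_) (sym (+-identityʳ _)) ⟩
        2 * (m ∸ j) ∎
      where
      open ≤-Reasoning
      linearise : ∀ a b → 𝟙 a * X ^ 𝟙 b ≤ 𝟙 a + (X ∸ 1) * 𝟙 b
      linearise false b = z≤n
      linearise true false rewrite *-zeroʳ (X ∸ 1) = ≤-refl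
      linearise true true rewrite *-identityʳ X | +-identityʳ X | *-identityʳ (X ∸ 1) = m≤n+m∸n X 1

    weightedCount≤ : ∀ k F j → unused F ≡ m ∸ j →
      weightedCount k F j ≤ 2 ^ (u ∸ j) * fallingFactorial (m ∸ j) k
    weightedCount≤ zero F j e rewrite *-identityʳ (2 ^ (u ∸ j)) = m^n>0 2 (u ∸ j)
    weightedCount≤ (suc k) F j e = begin
        weightedCount (suc k) F j
          ≡⟨ weightedCount-suc k F j ⟩
        sumBelow m (λ i → 𝟙 (not (elemᵇ (suc i) F)) * (weight j (suc i) * weightedCount k (suc i ∷ F) (suc j)))
          ≤⟨ sumBelow-mono m term ⟩
        sumBelow m (λ i → 𝟙 (not (elemᵇ (suc i) F)) * weight j (suc i) * B)
          ≡⟨ sumBelow-*ʳ B _ m ⟩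
        sumBelow m (λ i → 𝟙 (not (elemᵇ (suc i) F)) * weight j (suc i)) * B
          ≤⟨ *-monoˡ-≤ B (weightedStep≤ F j e) ⟩
        stepFactor j * (m ∸ j) * (2 ^ (u ∸ suc j) * fallingFactorial (m ∸ suc j) k)
          ≡⟨ solve 4 (λ s a p f → s :* a :* (p :* f) := s :* p :* (a :* f)) refl
                     (stepFactor j) (m ∸ j) (2 ^ (u ∸ suc j)) (fallingFactorial (m ∸ suc j) k) ⟩
        stepFactor j * 2 ^ (u ∸ suc j) * ((m ∸ j) * fallingFactorial (m ∸ suc j) k)
          ≡⟨ cong₂ _*_ (stepFactor-^ j) (cong (λ a → (m ∸ j) * fallingFactorial a k) (sym (pred[m∸n]≡m∸[1+n] m j))) ⟩
        2 ^ (u ∸ j) * fallingFactorial (m ∸ j) (suc k) ∎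
      where
      open ≤-Reasoning
      open +-*-Solver
      B = 2 ^ (u ∸ suc j) * fallingFactorial (m ∸ suc j) k
      term : ∀ i → i < m → 𝟙 (not (elemᵇ (suc i) F)) * (weight j (suc i) * weightedCount k (suc i ∷ F) (suc j))
                          ≤ 𝟙 (not (elemᵇ (suc i) F)) * weight j (suc i) * B
      term i i<m with elemᵇ (suc i) F in i∉F
      ... | true = z≤n
      ... | false rewrite +-identityʳ (weight j (suc i) * weightedCount k (suc i ∷ F) (suc j)) | +-identityʳ (weight j (suc i)) =
        *-monoʳ-≤ (weight j (suc i)) (weightedCount≤ k (suc i ∷ F) (suc j)
          (trans (cong pred (sym (unused-∷ F i i<m i∉F))) (trans (cong pred e) (pred[m∸n]≡m∸[1+n] m j))))

    markov : (P : List ℕ → Bool) (h : ℕ) → 1 ≤ X → (∀ σ → P σ ≡ true → h ≤ hits 0 σ) →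
      length (filterᵇ P (matchings m)) * X ^ h ≤ 2 ^ u * totalCount m
    markov P h X≥1 P⇒hits = begin
        length (filterᵇ P (matchings m)) * X ^ h
          ≡⟨ cong (_* X ^ h) (trans (length-filterᵇ P (matchings m)) (sumOver-filterᵇ nodupᵇ (𝟙 ∘ P) (allLists m m))) ⟩
        sumOver (λ σ → 𝟙 (nodupᵇ σ) * 𝟙 (P σ)) (allLists m m) * X ^ h
          ≡⟨ *-comm _ (X ^ h) ⟩
        X ^ h * sumOver (λ σ → 𝟙 (nodupᵇ σ) * 𝟙 (P σ)) (allLists m m)
          ≡⟨ sym (sumOver-*ˡ (X ^ h) _ (allLists m m)) ⟩
        sumOver (λ σ → X ^ h * (𝟙 (nodupᵇ σ) * 𝟙 (P σ))) (allLists m m)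
          ≤⟨ sumOver-mono term (allLists m m) ⟩
        weightedCount m [] 0
          ≤⟨ weightedCount≤ m [] 0 unused-[] ⟩
        2 ^ u * fallingFactorial m m
          ≤⟨ *-monoʳ-≤ (2 ^ u) fallingFactorial≤totalCount ⟩
        2 ^ u * totalCount m ∎
      where
      open ≤-Reasoning
      instance _ = >-nonZero X≥1
      term : ∀ σ → X ^ h * (𝟙 (nodupᵇ σ) * 𝟙 (P σ)) ≤ 𝟙 (fresh [] σ) * X ^ hits 0 σ
      term σ rewrite fresh-[] σ with nodupᵇ σ | P σ in Pσ
      ... | false | _ rewrite *-zeroʳ (X ^ h) = z≤n
      ... | true | false rewrite *-zeroʳ (X ^ h) = z≤n
      ... | true | true rewrite *-identityʳ (X ^ h) | +-identityʳ (X ^ hits 0 σ) = ^-monoʳ-≤ X (P⇒hits σ Pσ)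

mate-of-odd : ∀ σ v → v % 2 ≡ 1 → mate σ v ≡ 2 * lookupD σ (v / 2)
mate-of-odd σ v v-odd rewrite v-odd = refl

mate-of-even : ∀ σ v → v % 2 ≡ 0 → mate σ v ≡ 2 * posOf (v / 2) σ ∸ 1
mate-of-even σ v v-even rewrite v-even = refl

odd≡ : ∀ i → 2 * suc i ∸ 1 ≡ 1 + i * 2
odd≡ i = cong (_∸ 1) (*-comm 2 (suc i))

mate-odd : ∀ σ i → mate σ (2 * suc i ∸ 1) ≡ 2 * lookupD σ i
mate-odd σ i rewrite odd≡ i =
  trans (mate-of-odd σ (1 + i * 2) ([m+kn]%n≡m%n 1 i 2)) (cong (λ k → 2 * lookupD σ k) half)
  where
  half : (1 + i * 2) / 2 ≡ i
  half = trans (+-distrib-/ 1 (i * 2) (subst (λ z → 1 % 2 + z < 2) (sym (m*n%n≡0 i 2)) (s≤s (s≤s z≤n))))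
               (m*n/n≡m i 2)

mate-even : ∀ σ i → mate σ (2 * i) ≡ 2 * posOf i σ ∸ 1
mate-even σ i rewrite *-comm 2 i =
  trans (mate-of-even σ (i * 2) (m*n%n≡0 i 2)) (cong (λ k → 2 * posOf k σ ∸ 1) (m*n/n≡m i 2))

all-applyUpTo : ∀ (f : ℕ → Bool) g n → all f (applyUpTo g n) ≡ true → ∀ i → i < n → f (g i) ≡ true
all-applyUpTo f g (suc n) e zero p = ∧-conicalˡ _ _ e
all-applyUpTo f g (suc n) e (suc i) (s≤s p) = all-applyUpTo f (g ∘ suc) n (∧-conicalʳ (f (g 0)) _ e) i p

elemᵇ-applyUpTo : ∀ y g n → elemᵇ y (applyUpTo g n) ≡ true → ∃[ i ] (i < n × y ≡ g i)
elemᵇ-applyUpTo y g (suc n) e with y ≡ᵇ g 0 in y≡g0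
... | true = 0 , s≤s z≤n , ≡ᵇ-true⇒≡ y (g 0) y≡g0
... | false with elemᵇ-applyUpTo y (g ∘ suc) n e
... | i , i<n , y≡gi = suc i , s≤s i<n , y≡gi

lookupD-posOf : ∀ x σ q → posOf x σ ≡ suc q → lookupD σ q ≡ x
lookupD-posOf x (y ∷ σ) q e with x ≡ᵇ y in x≡y
lookupD-posOf x (y ∷ σ) zero e | true = sym (≡ᵇ-true⇒≡ x y x≡y)
lookupD-posOf x (y ∷ σ) q e | false with posOf x σ in p
... | zero = ⊥-elim (0≢1+n e)
lookupD-posOf x (y ∷ σ) (suc q) refl | false | suc r = lookupD-posOf x σ r p

range1≡ : ∀ t → range1 t ≡ applyUpTo suc t
range1≡ t = map-upTo suc t

evensUpTo≡ : ∀ t → evensUpTo t ≡ applyUpTo (λ k → 2 * suc k) t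
evensUpTo≡ t = trans (cong (map (2 *_)) (range1≡ t)) (map-applyUpTo suc (2 *_) t)

oddsUpTo≡ : ∀ t → oddsUpTo t ≡ applyUpTo (λ k → 2 * suc k ∸ 1) t
oddsUpTo≡ t = trans (cong (map (λ k → 2 * k ∸ 1)) (range1≡ t)) (map-applyUpTo suc (λ k → 2 * k ∸ 1) t)

inPrefix : ℕ → ℕ → Bool
inPrefix t x = (0 <ᵇ x) ∧ (x ≤ᵇ t)

count-inPrefix : ∀ t v → sumBelow t (λ i → 𝟙 (v ≡ᵇ suc i)) ≡ 𝟙 (inPrefix t v)
count-inPrefix t zero = trans (sumBelow-const 0 t) (*-zeroʳ t)
count-inPrefix t (suc v) = trans (sumBelow-cong t (λ i _ → cong 𝟙 (≡ᵇ-sym v i))) (count-≡ᵇ v t)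

module _ (t : ℕ) (σ : List ℕ) where

  prefixHits : ℕ
  prefixHits = sumBelow t (λ i → 𝟙 (inPrefix t (lookupD σ i)))

  oddSide evenSide : ℕ → Bool
  oddSide i = elemᵇ (mate σ (2 * i ∸ 1)) (evensUpTo t)
  evenSide i = elemᵇ (mate σ (2 * i)) (oddsUpTo t)

  oddSide⇒inPrefix : ∀ i → 𝟙 (oddSide (suc i)) ≤ 𝟙 (inPrefix t (lookupD σ i))
  oddSide⇒inPrefix i with oddSide (suc i) in e
  ... | false = z≤n
  ... | true with elemᵇ-applyUpTo (2 * lookupD σ i) (λ k → 2 * suc k) t
                    (subst₂ (λ a b → elemᵇ a b ≡ true) (mate-odd σ i) (evensUpTo≡ t) e)
  ... | k , k<t , σᵢ≡ rewrite *-cancelˡ-≡ (lookupD σ i) (suc k) 2 σᵢ≡ = ≤-reflexive (cong 𝟙 (sym (<⇒<ᵇ≡true k<t)))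

  evenSide⇒preimage : ∀ i → 𝟙 (evenSide (suc i)) ≤ sumBelow t (λ j → 𝟙 (lookupD σ j ≡ᵇ suc i))
  evenSide⇒preimage i with evenSide (suc i) in e
  ... | false = z≤n
  ... | true with posOf (suc i) σ in p | elemᵇ-applyUpTo (2 * posOf (suc i) σ ∸ 1) (λ k → 2 * suc k ∸ 1) t
                    (subst₂ (λ a b → elemᵇ a b ≡ true) (mate-even σ (suc i)) (oddsUpTo≡ t) e)
  ... | zero | k , k<t , q rewrite odd≡ k = ⊥-elim (0≢1+n q)
  ... | suc j | k , k<t , q rewrite odd≡ k | odd≡ j with *-cancelʳ-≡ j k 2 (suc-injective q)
  ... | refl = ≤-trans (≤-reflexive (cong 𝟙 (sym (trans (cong (_≡ᵇ suc i) (lookupD-posOf (suc i) σ j p)) (≡ᵇ-refl (suc i))))))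
                       (sumBelow-term (λ j → 𝟙 (lookupD σ j ≡ᵇ suc i)) t j k<t)

  good⇒prefixHits : isGood t σ ≡ true → t ≤ 2 * prefixHits
  good⇒prefixHits good = begin
      t
        ≡⟨ sym (sumBelow-1 t) ⟩
      sumBelow t (λ _ → 1)
        ≤⟨ sumBelow-mono t (λ i i<t → some-side (oddSide (suc i)) (evenSide (suc i)) (good-at i i<t)) ⟩
      sumBelow t (λ i → 𝟙 (oddSide (suc i)) + 𝟙 (evenSide (suc i)))
        ≡⟨ sumBelow-+ _ _ t ⟩
      sumBelow t (λ i → 𝟙 (oddSide (suc i))) + sumBelow t (λ i → 𝟙 (evenSide (suc i)))
        ≤⟨ +-mono-≤ (sumBelow-mono t (λ i _ → oddSide⇒inPrefix i)) (sumBelow-mono t (λ i _ → evenSide⇒preimage i)) ⟩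
      prefixHits + sumBelow t (λ i → sumBelow t (λ j → 𝟙 (lookupD σ j ≡ᵇ suc i)))
        ≡⟨ cong (prefixHits +_) (sumBelow-swap (λ i j → 𝟙 (lookupD σ j ≡ᵇ suc i)) t t) ⟩
      prefixHits + sumBelow t (λ j → sumBelow t (λ i → 𝟙 (lookupD σ j ≡ᵇ suc i)))
        ≡⟨ cong (prefixHits +_) (trans (sumBelow-cong t (λ j _ → count-inPrefix t (lookupD σ j))) (sym (+-identityʳ _))) ⟩
      2 * prefixHits ∎
    where
    open ≤-Reasoning
    good-at : ∀ i → i < t → (oddSide (suc i) ∨ evenSide (suc i)) ≡ true
    good-at = all-applyUpTo (λ i → oddSide i ∨ evenSide i) suc t
                (subst (λ xs → all (λ i → oddSide i ∨ evenSide i) xs ≡ true) (range1≡ t) good)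
    some-side : ∀ a b → a ∨ b ≡ true → 1 ≤ 𝟙 a + 𝟙 b
    some-side true b e = s≤s z≤n
    some-side false true e = s≤s z≤n

⊆⇒∈sublists : ∀ {ys xs} → ys ⊆ xs → ys ∈ sublists xs
⊆⇒∈sublists [] = here refl
⊆⇒∈sublists (x ∷ʳ p) = ∈-++⁺ˡ (⊆⇒∈sublists p)
⊆⇒∈sublists {xs = x ∷ xs} (refl ∷ p) = ∈-++⁺ʳ (sublists xs) (∈-map⁺ (x ∷_) (⊆⇒∈sublists p))

all-∈ : ∀ {A : Set} (f : A → Bool) {x xs} → all f xs ≡ true → x ∈ xs → f x ≡ true
all-∈ f e (here refl) = ∧-conicalˡ _ _ e
all-∈ f {xs = y ∷ xs} e (there x∈xs) = all-∈ f (∧-conicalʳ (f y) _ e) x∈xs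

any-take-filterᵇ : ∀ (p q : ℕ → Bool) → (∀ x → p x ≡ true → q x ≡ false) →
  ∀ k xs → any q (take k (filterᵇ p xs)) ≡ false
any-take-filterᵇ p q p⇒¬q zero xs = refl
any-take-filterᵇ p q p⇒¬q (suc k) [] = refl
any-take-filterᵇ p q p⇒¬q (suc k) (x ∷ xs) with p x in px
... | true rewrite p⇒¬q x px = any-take-filterᵇ p q p⇒¬q k xs
... | false = any-take-filterᵇ p q p⇒¬q (suc k) xs

quarter-bound : ∀ h b n a t → t ≤ h + b + n → n ≤ a → a * 2 ≤ t → b * 4 ≤ t → t ≤ 4 * h
quarter-bound h b n a t p q r s = +-cancelʳ-≤ (3 * t) t (4 * h) (begin
    t + 3 * t                      ≡⟨ solve 1 (λ t → t :+ con 3 :* t := con 4 :* t) refl t ⟩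
    4 * t                          ≤⟨ *-monoʳ-≤ 4 p ⟩
    4 * (h + b + n)                ≡⟨ solve 3 (λ h b n → con 4 :* (h :+ b :+ n) := con 4 :* h :+ (b :* con 4 :+ con 4 :* n)) refl h b n ⟩
    4 * h + (b * 4 + 4 * n)        ≤⟨ +-monoʳ-≤ (4 * h) (+-mono-≤ s (*-monoʳ-≤ 4 q)) ⟩
    4 * h + (t + 4 * a)            ≡⟨ solve 3 (λ h t a → h :+ (t :+ con 4 :* a) := h :+ t :+ con 2 :* (a :* con 2)) refl (4 * h) t a ⟩
    4 * h + t + 2 * (a * 2)        ≤⟨ +-monoʳ-≤ (4 * h + t) (*-monoʳ-≤ 2 r) ⟩
    4 * h + t + 2 * t              ≡⟨ solve 2 (λ h t → h :+ t :+ con 2 :* t := h :+ con 3 :* t) refl (4 * h) t ⟩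
    4 * h + 3 * t                  ∎)
  where
  open ≤-Reasoning
  open +-*-Solver

fixedAt : ℕ → ℕ → Bool
fixedAt j x = x ≡ᵇ suc j

module _ (t : ℕ) (σ : List ℕ) where

  isFixed : ℕ → Bool
  isFixed i = mate σ (2 * i ∸ 1) ≡ᵇ 2 * i

  nonFixed : List ℕ
  nonFixed = filterᵇ (not ∘ isFixed) (range1 t)

  selfGood⇒few-nonFixed : isSelfGood t σ ≡ true → length nonFixed < t / 2
  selfGood⇒few-nonFixed selfGood with t / 2 ≤? length nonFixed
  ... | no p = ≰⇒> p
  ... | yes p = contradiction (trans (sym no-fixed-in-T₀) fixed-in-T₀) λ ()
    where
    T₀ : List ℕ
    T₀ = take (t / 2) nonFixed
    T₀∈half : T₀ ∈ halfSubsets t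
    T₀∈half = ∈-filter⁺ (λ T → T? (length T ≡ᵇ t / 2))
                (⊆⇒∈sublists (⊆-trans (take-⊆ (t / 2) nonFixed) (filter-⊆ (T? ∘ not ∘ isFixed) (range1 t))))
                (≡⇒≡ᵇ (length T₀) (t / 2) (trans (length-take (t / 2) nonFixed) (m≤n⇒m⊓n≡m p)))
    no-fixed-in-T₀ : any isFixed T₀ ≡ false
    no-fixed-in-T₀ = any-take-filterᵇ (not ∘ isFixed) isFixed (λ _ → not-injective) (t / 2) (range1 t)
    fixed-in-T₀ : any isFixed T₀ ≡ true
    fixed-in-T₀ = all-∈ (any isFixed) (∧-conicalʳ (isGood t σ) _ selfGood) T₀∈half

  fixedPrefix : ℕ → ℕ
  fixedPrefix u = sumBelow u (λ i → 𝟙 (fixedAt i (lookupD σ i)))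

  isFixed⇒fixedAt : ∀ j → 𝟙 (isFixed (suc j)) ≤ 𝟙 (fixedAt j (lookupD σ j))
  isFixed⇒fixedAt j with isFixed (suc j) in e
  ... | false = z≤n
  ... | true rewrite *-cancelˡ-≡ (lookupD σ j) (suc j) 2
                       (≡ᵇ-true⇒≡ _ _ (trans (cong (_≡ᵇ 2 * suc j) (sym (mate-odd σ j))) e)) =
    ≤-reflexive (cong 𝟙 (sym (≡ᵇ-refl (suc j))))

  fixed+nonFixed : sumBelow t (λ j → 𝟙 (isFixed (suc j))) + length nonFixed ≡ t
  fixed+nonFixed = begin
      sumBelow t (λ j → 𝟙 (isFixed (suc j))) + length nonFixed
        ≡⟨ cong (sumBelow t (λ j → 𝟙 (isFixed (suc j))) +_)
                (trans (length-filterᵇ (not ∘ isFixed) (range1 t)) (sumOver-range1 (𝟙 ∘ not ∘ isFixed) t)) ⟩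
      sumBelow t (λ j → 𝟙 (isFixed (suc j))) + sumBelow t (λ j → 𝟙 (not (isFixed (suc j))))
        ≡⟨ sym (sumBelow-+ _ _ t) ⟩
      sumBelow t (λ j → 𝟙 (isFixed (suc j)) + 𝟙 (not (isFixed (suc j))))
        ≡⟨ sumBelow-cong t (λ j _ → 𝟙+𝟙-not (isFixed (suc j))) ⟩
      sumBelow t (λ _ → 1)
        ≡⟨ sumBelow-1 t ⟩
      t ∎
    where
    open ≡-Reasoning
    𝟙+𝟙-not : ∀ b → 𝟙 b + 𝟙 (not b) ≡ 1
    𝟙+𝟙-not true = refl
    𝟙+𝟙-not false = refl

  selfGood⇒fixedPrefix : isSelfGood t σ ≡ true → t ≤ 4 * fixedPrefix (t ∸ t / 4)
  selfGood⇒fixedPrefix selfGood =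
    quarter-bound (fixedPrefix u) b (length nonFixed) (t / 2) t t≤H+b+n
      (<⇒≤ (selfGood⇒few-nonFixed selfGood)) (m/n*n≤m t 2) (m/n*n≤m t 4)
    where
    open ≤-Reasoning
    b = t / 4
    u = t ∸ b
    t≤H+b+n : t ≤ fixedPrefix u + b + length nonFixed
    t≤H+b+n = begin
      t
        ≡⟨ sym fixed+nonFixed ⟩
      sumBelow t (λ j → 𝟙 (isFixed (suc j))) + length nonFixed
        ≡⟨ cong (λ z → sumBelow z (λ j → 𝟙 (isFixed (suc j))) + length nonFixed) (sym (m∸n+n≡m (m/n≤m t 4))) ⟩
      sumBelow (u + b) (λ j → 𝟙 (isFixed (suc j))) + length nonFixed
        ≤⟨ +-monoˡ-≤ (length nonFixed) (sumBelow-+-≤ u b _ (λ i → 𝟙≤1 (isFixed (suc i)))) ⟩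
      sumBelow u (λ j → 𝟙 (isFixed (suc j))) + b + length nonFixed
        ≤⟨ +-monoˡ-≤ (length nonFixed) (+-monoˡ-≤ b (sumBelow-mono u (λ j _ → isFixed⇒fixedAt j))) ⟩
      fixedPrefix u + b + length nonFixed ∎

^-distribʳ-* : ∀ a b n → (a * b) ^ n ≡ a ^ n * b ^ n
^-distribʳ-* a b zero = refl
^-distribʳ-* a b (suc n) rewrite ^-distribʳ-* a b n =
  solve 4 (λ a b x y → (a :* b) :* (x :* y) := (a :* x) :* (b :* y)) refl a b (a ^ n) (b ^ n)
  where open +-*-Solver

⌈/⌉≤ : ∀ k t a → t ≤ suc k * a → (t + k) / suc k ≤ a
⌈/⌉≤ k t a t≤ = s≤s⁻¹ (m<n*o⇒m/o<n (begin-strict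
    t + k               ≤⟨ +-monoˡ-≤ k t≤ ⟩
    suc k * a + k       <⟨ +-monoʳ-< (suc k * a) (n<1+n k) ⟩
    suc k * a + suc k   ≡⟨ solve 2 (λ k a → k :* a :+ k := (con 1 :+ a) :* k) refl (suc k) a ⟩
    suc a * suc k       ∎))
  where
  open ≤-Reasoning
  open +-*-Solver

≤-*⌈/⌉ : ∀ k t → t ≤ suc k * ((t + k) / suc k)
≤-*⌈/⌉ k t = +-cancelʳ-≤ k t (suc k * q) (begin
    t + k                         ≡⟨ m≡m%n+[m/n]*n (t + k) (suc k) ⟩
    (t + k) % suc k + q * suc k   ≤⟨ +-monoˡ-≤ (q * suc k) (s≤s⁻¹ (m%n<n (t + k) (suc k))) ⟩
    k + q * suc k                 ≡⟨ trans (+-comm k _) (cong (_+ k) (*-comm q (suc k))) ⟩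
    suc k * q + k                 ∎)
  where
  open ≤-Reasoning
  q = (t + k) / suc k

-- After raising to the 8th power, 256 = 2 ^ 8 absorbs the factor 2 ^ t.
power-bound : ∀ C T X h t r q N → C * X ^ h ≤ 2 ^ t * T → 1 ≤ X → t ≤ r * h → r * q ≡ 8 →
  256 * N ≤ X ^ q → C ^ 8 * N ^ t ≤ T ^ 8
power-bound C T X h t r q N markov X≥1 t≤rh rq≡8 X^q≥ = *-cancelˡ-≤ (2 ^ (8 * t)) (begin
    2 ^ (8 * t) * (C ^ 8 * N ^ t) ≡⟨ solve 3 (λ a c d → a :* (c :* d) := c :* (a :* d)) refl (2 ^ (8 * t)) (C ^ 8) (N ^ t) ⟩
    C ^ 8 * (2 ^ (8 * t) * N ^ t) ≡⟨ cong (λ z → C ^ 8 * (z * N ^ t)) (sym (^-*-assoc 2 8 t)) ⟩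
    C ^ 8 * (256 ^ t * N ^ t)     ≡⟨ cong (C ^ 8 *_) (sym (^-distribʳ-* 256 N t)) ⟩
    C ^ 8 * (256 * N) ^ t         ≤⟨ *-monoʳ-≤ (C ^ 8) (^-monoˡ-≤ t X^q≥) ⟩
    C ^ 8 * (X ^ q) ^ t           ≡⟨ cong (C ^ 8 *_) (^-*-assoc X q t) ⟩
    C ^ 8 * X ^ (q * t)           ≤⟨ *-monoʳ-≤ (C ^ 8) (^-monoʳ-≤ X qt≤8h) ⟩
    C ^ 8 * X ^ (h * 8)           ≡⟨ cong (C ^ 8 *_) (sym (^-*-assoc X h 8)) ⟩
    C ^ 8 * (X ^ h) ^ 8           ≡⟨ sym (^-distribʳ-* C (X ^ h) 8) ⟩
    (C * X ^ h) ^ 8               ≤⟨ ^-monoˡ-≤ 8 markov ⟩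
    (2 ^ t * T) ^ 8               ≡⟨ ^-distribʳ-* (2 ^ t) T 8 ⟩
    (2 ^ t) ^ 8 * T ^ 8           ≡⟨ cong (_* T ^ 8) (trans (^-*-assoc 2 t 8) (cong (2 ^_) (*-comm t 8))) ⟩
    2 ^ (8 * t) * T ^ 8           ∎)
  where
  open ≤-Reasoning
  open +-*-Solver
  instance _ = >-nonZero X≥1
  instance _ = m^n≢0 2 (8 * t)
  qt≤8h : q * t ≤ h * 8
  qt≤8h = begin
    q * t       ≤⟨ *-monoʳ-≤ q t≤rh ⟩
    q * (r * h) ≡⟨ solve 3 (λ q r h → q :* (r :* h) := h :* (r :* q)) refl q r h ⟩
    h * (r * q) ≡⟨ cong (h *_) rq≡8 ⟩
    h * 8       ∎

X+2≤2X : ∀ X n → 8192 ≤ n → n < 2 * (X + 2) ^ 4 → X + 2 ≤ 2 * X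
X+2≤2X 0 n n≥ n< = ⊥-elim (≤⇒≯ (≤ᵇ⇒≤ 32 8192 _) (≤-trans (s≤s n≥) n<))
X+2≤2X 1 n n≥ n< = ⊥-elim (≤⇒≯ (≤ᵇ⇒≤ 162 8192 _) (≤-trans (s≤s n≥) n<))
X+2≤2X X@(suc (suc _)) n _ _ = subst (X + 2 ≤_) (cong (X +_) (sym (+-identityʳ X))) (+-monoʳ-≤ X (s≤s (s≤s z≤n)))

large-weight-good : ∀ m t X → 8192 ≤ m → t ^ 4 ≤ 2 * m → m < (X + 2) * t → 256 * (2 * m) ≤ X ^ 4
large-weight-good m t X m≥ t⁴≤ m< = <⇒≤ (*-cancelˡ-< 32 _ _ (begin-strict
    32 * (256 * (2 * m)) ≡⟨ solve 1 (λ m → con 32 :* (con 256 :* (con 2 :* m)) := con 16384 :* m) refl m ⟩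
    16384 * m            ≤⟨ *-monoˡ-≤ m (*-mono-≤ {2} {m} {8192} {m} (≤-trans (s≤s (s≤s z≤n)) m≥) m≥) ⟩
    m * m * m            ≡⟨ solve 1 (λ m → m :* m :* m := m :* (m :* (m :* con 1))) refl m ⟩
    m ^ 3                <⟨ m³< ⟩
    2 * Y ^ 4            ≤⟨ *-monoʳ-≤ 2 (^-monoˡ-≤ 4 (X+2≤2X X (m ^ 3) (≤-trans m≥ m≤m³) m³<)) ⟩
    2 * (2 * X) ^ 4      ≡⟨ solve 1 (λ x → con 2 :* ((con 2 :* x) :^ 4) := con 32 :* (x :^ 4)) refl X ⟩
    32 * X ^ 4           ∎))
  where
  open ≤-Reasoning
  open +-*-Solver
  Y = X + 2
  instance _ = >-nonZero (≤-trans (s≤s z≤n) m≥)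
  m³< : m ^ 3 < 2 * Y ^ 4
  m³< = *-cancelˡ-< m _ _ (begin-strict
    m ^ 4             <⟨ ^-monoˡ-< 4 m< ⟩
    (Y * t) ^ 4       ≡⟨ ^-distribʳ-* Y t 4 ⟩
    Y ^ 4 * t ^ 4     ≤⟨ *-monoʳ-≤ (Y ^ 4) t⁴≤ ⟩
    Y ^ 4 * (2 * m)   ≡⟨ solve 2 (λ y m → y :* (con 2 :* m) := m :* (con 2 :* y)) refl (Y ^ 4) m ⟩
    m * (2 * Y ^ 4)   ∎)
  m≤m³ : m ≤ m ^ 3
  m≤m³ = begin
    m         ≡⟨ sym (*-identityʳ m) ⟩
    m * 1     ≤⟨ *-monoʳ-≤ m (m^n>0 m 2) ⟩
    m * m ^ 2 ∎

large-weight-self : ∀ m X → 8192 ≤ m → m ≤ 4 * X → 256 * (2 * m) ≤ X ^ 2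
large-weight-self m X m≥ m≤4X = *-cancelˡ-≤ 16 (begin
    16 * (256 * (2 * m)) ≡⟨ solve 1 (λ m → con 16 :* (con 256 :* (con 2 :* m)) := con 8192 :* m) refl m ⟩
    8192 * m             ≤⟨ *-monoˡ-≤ m m≥ ⟩
    m * m                ≤⟨ *-mono-≤ m≤4X m≤4X ⟩
    (4 * X) * (4 * X)    ≡⟨ solve 1 (λ x → (con 4 :* x) :* (con 4 :* x) := con 16 :* (x :* (x :* con 1))) refl X ⟩
    16 * X ^ 2           ∎)
  where
  open ≤-Reasoning
  open +-*-Solver

positive-base : ∀ X m → 1 ≤ m → 256 * (2 * m) ≤ X ^ 4 → 1 ≤ X
positive-base zero (suc m) _ ()
positive-base (suc X) m _ _ = s≤s z≤n

good-bound : ∀ m t → 8192 ≤ m → t ≤ m → t ^ 4 ≤ 2 * m → goodCount m t ^ 8 * (2 * m) ^ t ≤ totalCount m ^ 8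
good-bound m zero _ _ _ rewrite *-identityʳ (goodCount m 0 ^ 8) =
  ^-monoˡ-≤ 8 (length-filter (T? ∘ isGood 0) (matchings m))
good-bound m t@(suc _) m≥ t≤m t⁴≤ =
  power-bound (goodCount m t) (totalCount m) X h t 2 4 (2 * m) markov-good X≥1 (≤-*⌈/⌉ 1 t) refl X⁴≥
  where
  open ≤-Reasoning
  X = (m ∸ t) / t
  h = (t + 1) / 2
  open WeightedCount m t X (λ _ → inPrefix t)
  m<[X+2]t : m < (X + 2) * t
  m<[X+2]t = begin-strict
    m                             ≡⟨ sym (m+[n∸m]≡n t≤m) ⟩
    t + (m ∸ t)                   ≡⟨ cong (t +_) (m≡m%n+[m/n]*n (m ∸ t) t) ⟩
    t + ((m ∸ t) % t + X * t)     <⟨ +-monoʳ-< t (+-monoˡ-< (X * t) (m%n<n (m ∸ t) t)) ⟩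
    t + (t + X * t)               ≡⟨ solve 2 (λ t x → t :+ (t :+ x :* t) := (x :+ con 2) :* t) refl t X ⟩
    (X + 2) * t                   ∎
    where open +-*-Solver
  X⁴≥ : 256 * (2 * m) ≤ X ^ 4
  X⁴≥ = large-weight-good m t X m≥ t⁴≤ m<[X+2]t
  X≥1 : 1 ≤ X
  X≥1 = positive-base X m (≤-trans (s≤s z≤n) m≥) X⁴≥
  sparse : ∀ j → j < t → (X ∸ 1) * sumBelow m (λ i → 𝟙 (inPrefix t (suc i))) ≤ m ∸ j
  sparse j j<t = begin
    (X ∸ 1) * sumBelow m (λ i → 𝟙 (i <ᵇ t)) ≤⟨ *-mono-≤ (m∸n≤m X 1) (count-<ᵇ m t) ⟩
    X * t                                  ≤⟨ m/n*n≤m (m ∸ t) t ⟩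
    m ∸ t                                  ≤⟨ ∸-monoʳ-≤ m (<⇒≤ j<t) ⟩
    m ∸ j                                  ∎
  markov-good : goodCount m t * X ^ h ≤ 2 ^ t * totalCount m
  markov-good = markov sparse (isGood t) h X≥1
    (λ σ good → ≤-trans (⌈/⌉≤ 1 t (prefixHits t σ) (good⇒prefixHits t σ good)) (hits-≥ (λ _ → refl) σ))

selfGood-bound : ∀ m t → 8192 ≤ m → t ≤ m → selfGoodCount m t ^ 8 * (2 * m) ^ t ≤ totalCount m ^ 8
selfGood-bound m t m≥ t≤m =
  power-bound (selfGoodCount m t) (totalCount m) X h t 4 2 (2 * m) markov-self (s≤s z≤n) (≤-*⌈/⌉ 3 t) refl
    (large-weight-self m X m≥ m≤4X)
  where
  open ≤-Reasoning
  b = t / 4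
  u = t ∸ b
  X = suc (m ∸ t + b)
  h = (t + 3) / 4
  open WeightedCount m u X fixedAt
  sparse : ∀ j → j < u → (m ∸ t + b) * sumBelow m (λ i → 𝟙 (fixedAt j (suc i))) ≤ m ∸ j
  sparse j j<u = begin
    (m ∸ t + b) * sumBelow m (λ i → 𝟙 (i ≡ᵇ j)) ≡⟨ cong ((m ∸ t + b) *_) (count-≡ᵇ j m) ⟩
    (m ∸ t + b) * 𝟙 (j <ᵇ m)                   ≤⟨ *-monoʳ-≤ (m ∸ t + b) (𝟙≤1 (j <ᵇ m)) ⟩
    (m ∸ t + b) * 1                            ≡⟨ *-identityʳ _ ⟩
    m ∸ t + b                                  ≤⟨ m+n≤o⇒m≤o∸n (m ∸ t + b) m∸t+b+j≤m ⟩
    m ∸ j                                      ∎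
    where
    m∸t+b+j≤m : m ∸ t + b + j ≤ m
    m∸t+b+j≤m = begin
      m ∸ t + b + j   ≡⟨ +-assoc (m ∸ t) b j ⟩
      m ∸ t + (b + j) ≤⟨ +-monoʳ-≤ (m ∸ t) (subst (b + j ≤_) (m∸n+n≡m (m/n≤m t 4))
                                                   (≤-trans (≤-reflexive (+-comm b j)) (+-monoˡ-≤ b (<⇒≤ j<u)))) ⟩
      m ∸ t + t       ≡⟨ m∸n+n≡m t≤m ⟩
      m               ∎
  markov-self : selfGoodCount m t * X ^ h ≤ 2 ^ t * totalCount m
  markov-self = ≤-trans
    (markov sparse (isSelfGood t) h (s≤s z≤n)
      (λ σ selfGood → ≤-trans (⌈/⌉≤ 3 t (fixedPrefix t σ u) (selfGood⇒fixedPrefix t σ selfGood)) (hits-≥ (λ _ → refl) σ)))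
    (*-monoˡ-≤ (totalCount m) (^-monoʳ-≤ 2 (m∸n≤m t b)))
  t≤4b+3 : t ≤ 4 * b + 3
  t≤4b+3 = begin
    t               ≡⟨ m≡m%n+[m/n]*n t 4 ⟩
    t % 4 + b * 4   ≤⟨ +-monoˡ-≤ (b * 4) (s≤s⁻¹ (m%n<n t 4)) ⟩
    3 + b * 4       ≡⟨ trans (+-comm 3 _) (cong (_+ 3) (*-comm b 4)) ⟩
    4 * b + 3       ∎
  m≤4X : m ≤ 4 * X
  m≤4X = begin
    m                               ≡⟨ sym (m∸n+n≡m t≤m) ⟩
    m ∸ t + t                       ≤⟨ +-monoʳ-≤ (m ∸ t) t≤4b+3 ⟩
    m ∸ t + (4 * b + 3)             ≤⟨ +-monoˡ-≤ (4 * b + 3) (m≤n*m (m ∸ t) 4) ⟩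
    4 * (m ∸ t) + (4 * b + 3)       ≤⟨ n≤1+n _ ⟩
    suc (4 * (m ∸ t) + (4 * b + 3)) ≡⟨ solve 2 (λ a b → con 1 :+ (con 4 :* a :+ (con 4 :* b :+ con 3))
                                                    := con 4 :* (con 1 :+ (a :+ b))) refl (m ∸ t) b ⟩
    4 * X                           ∎
    where open +-*-Solver

claim3p14 : ∃[ δa ] ∃[ δb ] ∃[ ca ] ∃[ cb ] ∃[ N0 ]
    (0 < δa × 0 < δb × 0 < ca × 0 < cb ×
     ((m : ℕ) → N0 ≤ 2 * m → (t : ℕ) → t ≤ m →
       (t ^ δb ≤ (2 * m) ^ δa →
          goodCount m t ^ cb * (2 * m) ^ (ca * t) ≤ totalCount m ^ cb)
       × ((2 * m) ^ δa < t ^ δb →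
          selfGoodCount m t ^ cb * (2 * m) ^ (ca * t) ≤ totalCount m ^ cb)))
claim3p14 = 1 , 4 , 1 , 8 , 16384 , s≤s z≤n , s≤s z≤n , s≤s z≤n , s≤s z≤n , bounds
  where
  bounds : (m : ℕ) → 16384 ≤ 2 * m → (t : ℕ) → t ≤ m →
    (t ^ 4 ≤ (2 * m) ^ 1 → goodCount m t ^ 8 * (2 * m) ^ (1 * t) ≤ totalCount m ^ 8)
    × ((2 * m) ^ 1 < t ^ 4 → selfGoodCount m t ^ 8 * (2 * m) ^ (1 * t) ≤ totalCount m ^ 8)
  bounds m 2m≥ t t≤m rewrite *-identityˡ t | *-identityʳ (2 * m) =
    (λ t⁴≤ → good-bound m t m≥ t≤m t⁴≤) , (λ _ → selfGood-bound m t m≥ t≤m)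
    where
    m≥ : 8192 ≤ m
    m≥ = *-cancelˡ-≤ 2 2m≥
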